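{- Let $m>1$ be a squarefree integer with positive divisors $1=d_1<d_2<\cdots<d_{\tau(m)}=m$. Suppose that $d_2/d_1=2$ and that $d_{i+1}/d_i<2$ for every index $i$ with $1<i<\tau(m)-1$ and $d_{i+1}\le P(m)$. Then $m$ is strictly $2$-dense.
   Context: $P(m)$ denotes the largest prime factor of $m$, and $\tau(m)$ the number of positive divisors of $m$. For a positive integer $n$ with divisors $1=d_1<\cdots<d_{\tau(n)}=n$, a squarefree $n$ is strictly $2$-dense if $d_{i+1}/d_i<2$ for all $i$ with $1<i<\tau(n)-1$, and $d_2/d_1=2=d_{\tau(n)}/d_{\tau(n)-1}$. -}

module Defs where

open import Data.Nat using (ℕ; zero; suc; _*_; _<_; _≤_; _∸_; _⊔_)
open import Data.Nat.Divisibility using (_∣_; _∣?_)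
open import Data.Nat.Primality using (Prime; prime?)
open import Data.List using (List; []; _∷_; filter; applyUpTo; length; foldr)
open import Data.Product using (_×_)
open import Relation.Nullary using (¬_)
open import Relation.Binary.PropositionalEquality using (_≡_)

divisors : ℕ → List ℕ
divisors m = filter (_∣? m) (applyUpTo suc m)

τ : ℕ → ℕ
τ m = length (divisors m)

-- 1-based access to a list (default 0 outside the range; only used in range)
at : List ℕ → ℕ → ℕ
at []       _             = 0
at (x ∷ xs) zero          = 0
at (x ∷ xs) (suc zero)    = x
at (x ∷ xs) (suc (suc i)) = at xs (suc i)

d : ℕ → ℕ → ℕ
d m i = at (divisors m) i

-- P(m): largest prime factor of m (0 if m has none)
P : ℕ → ℕ
P m = foldr _⊔_ 0 (filter prime? (divisors m))

Squarefree : ℕ → Set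
Squarefree n = ∀ p → Prime p → ¬ (p * p ∣ n)

-- strictly 2-dense (for squarefree n); ratios written multiplicatively
StrictlyTwoDense : ℕ → Set
StrictlyTwoDense n =
  Squarefree n
  × (∀ i → 1 < i → i < τ n ∸ 1 → d n (suc i) < 2 * d n i)
  × d n 2 ≡ 2 * d n 1
  × d n (τ n) ≡ 2 * d n (τ n ∸ 1)

module Submission where

-- Call a divisor z of m with x < z < 2x a bridge of x, and call m dense when every
-- divisor x ≥ 2 with 2x < m has a bridge.  The heart of the proof is an induction that
-- peels off the largest prime p of m = n·p (dense-from-below): if n is dense and every
-- divisor x ≥ 2 of m below p has a bridge, then m is dense (module DenseStep).  The key
-- point there is that the largest divisor a of m below p satisfies p < 2a; scaling
-- a < p < 2a, or a divisor of n between p and 2p, by a cofactor n / a resp. n / b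
-- produces the bridges of n and n/2, while the other divisors get theirs from n.
--
-- The theorem then reads: the hypotheses say that m is
-- dense below P(m), hence dense, which gives the middle ratios; d₂ = 2 gives 2 ∣ m, so
-- the second largest divisor is m/2.

open import Defs
open import Data.Nat
open import Data.Nat.Properties
open import Data.Nat.Divisibility
open import Data.Nat.Primality
open import Data.Nat.Primality.Factorisation using (factorise; PrimeFactorisation)
open import Data.Nat.Coprimality using (Coprime; coprime-divisor)
open import Data.Nat.ListAction using (product)
open import Data.Nat.Induction using (<-rec)
open import Data.List using (List; []; _∷_; filter; applyUpTo; length; foldr; _++_)
open import Data.List.Properties using (applyUpTo-∷ʳ; filter-++; filter-accept; filter-reject; length-++; ++-identityʳ; ++-assoc)
open import Data.List.Membership.Propositional using (_∈_)
open import Data.List.Membership.Propositional.Properties using (∈-filter⁺; ∈-applyUpTo⁺)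
open import Data.List.Relation.Unary.Any using (here; there)
open import Data.List.Relation.Unary.All using (All; _∷_)
open import Data.Product using (Σ; _×_; _,_)
open import Data.Sum using (inj₁; inj₂)
open import Data.Empty using (⊥; ⊥-elim)
open import Relation.Nullary using (¬_; yes; no)
open import Relation.Nullary.Decidable using (_×-dec_)
open import Relation.Unary using (Decidable)
open import Relation.Binary using (tri<; tri≈; tri>)
open import Relation.Binary.PropositionalEquality

prime≥2 : ∀ {p} → Prime p → 2 ≤ p
prime≥2 {p} p-prime = nonTrivial⇒n>1 p {{prime⇒nonTrivial p-prime}}

divisor≢0 : ∀ {z m} → z ∣ m → m ≢ 0 → z ≢ 0
divisor≢0 z∣m m≢0 refl = m≢0 (0∣⇒≡0 z∣m)

divisor≤ : ∀ {z m} → z ∣ m → m ≢ 0 → z ≤ m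
divisor≤ {m = zero}  _   m≢0 = ⊥-elim (m≢0 refl)
divisor≤ {m = suc _} z∣m _   = ∣⇒≤ z∣m

proper-divisor-half : ∀ {x n} → x ∣ n → x < n → 2 * x ≤ n
proper-divisor-half {x} x∣n x<n =
  subst (2 * x ≤_) (sym (m∣n⇒n≡quotient*m x∣n)) (*-monoˡ-≤ x (quotient>1 x∣n x<n))

no-divisor-above-half : ∀ {h z} → z ∣ 2 * h → h < z → z < 2 * h → ⊥
no-divisor-above-half {h} z∣2h h<z z<2h =
  <⇒≱ h<z (*-cancelˡ-≤ 2 (proper-divisor-half z∣2h z<2h))

half<whole : ∀ {x} → 1 ≤ x → x < 2 * x
half<whole {x} 1≤x = m<m+n x (subst (0 <_) (sym (+-identityʳ x)) 1≤x)

cancel-prime : ∀ {p z n} → Prime p → ¬ p ∣ z → z ∣ n * p → z ∣ n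
cancel-prime {p} {z} {n} p-prime p∤z z∣np =
  coprime-divisor z-coprime-p (subst (z ∣_) (*-comm n p) z∣np)
  where
  z-coprime-p : Coprime z p
  z-coprime-p {c} (c∣z , c∣p) with prime⇒irreducible p-prime c∣p
  ... | inj₁ c≡1 = c≡1
  ... | inj₂ refl = ⊥-elim (p∤z c∣z)

small-not-multiple : ∀ {p z} → z ≢ 0 → z < p → ¬ p ∣ z
small-not-multiple z≢0 z<p p∣z = <⇒≱ z<p (divisor≤ p∣z z≢0)

scale-between : ∀ k {u v} .{{_ : NonZero k}} → u < v → v < 2 * u →
                k * u < k * v × k * v < 2 * (k * u)
scale-between k {u} {v} u<v v<2u = *-monoʳ-< k u<v , kv<2ku
  where
  open ≤-Reasoning
  kv<2ku : k * v < 2 * (k * u)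
  kv<2ku = begin-strict
    k * v        <⟨ *-monoʳ-< k v<2u ⟩
    k * (2 * u)  ≡⟨ sym (*-assoc k 2 u) ⟩
    k * 2 * u    ≡⟨ cong (_* u) (*-comm k 2) ⟩
    2 * k * u    ≡⟨ *-assoc 2 k u ⟩
    2 * (k * u)  ∎

record Largest (Q : ℕ → Set) (a p : ℕ) : Set where
  field
    value   : ℕ
    holds   : Q value
    atLeast : a ≤ value
    below   : value < p
    maximal : ∀ y → value < y → y < p → ¬ Q y

largestBelow : ∀ {Q : ℕ → Set} → Decidable Q → ∀ p a → Q a → a < p → Largest Q a p
largestBelow {Q} Q? (suc q) a Qa a<1+q with Q? q | m≤n⇒m<n∨m≡n (≤-pred a<1+q)
... | yes Qq | _ = record
  { value = q ; holds = Qq ; atLeast = ≤-pred a<1+q ; below = n<1+n q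
  ; maximal = λ y q<y y<1+q _ → <-irrefl refl (≤-trans y<1+q q<y) }
... | no ¬Qq | inj₂ refl = ⊥-elim (¬Qq Qa)
... | no ¬Qq | inj₁ a<q = record
  { value = value ; holds = holds ; atLeast = atLeast ; below = m<n⇒m<1+n below
  ; maximal = maximal′ }
  where
  open Largest (largestBelow Q? q a Qa a<q)
  maximal′ : ∀ y → value < y → y < suc q → ¬ Q y
  maximal′ y c<y y<1+q with m≤n⇒m<n∨m≡n (≤-pred y<1+q)
  ... | inj₁ y<q  = maximal y c<y y<q
  ... | inj₂ refl = ¬Qq

prime-factor : ∀ n → 2 ≤ n → Σ ℕ λ q → Prime q × q ∣ n
prime-factor n@(suc _) 2≤n = first (factors f) (isFactorisation f) (factorsPrime f)
  where
  open PrimeFactorisation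
  f = factorise n
  first : (qs : List ℕ) → n ≡ product qs → All Prime qs → Σ ℕ λ q → Prime q × q ∣ n
  first []       n≡1 _ = ⊥-elim (<⇒≢ 2≤n (sym n≡1))
  first (q ∷ qs) n≡q·qs (q-prime ∷ _) = q , q-prime , divides (product qs) (trans n≡q·qs (*-comm q (product qs)))

without-prime-factors : ∀ {n} → n ≢ 0 → (∀ q → Prime q → ¬ q ∣ n) → n ≡ 1
without-prime-factors {n} n≢0 no-factor with n ≟ 1
... | yes n≡1 = n≡1
... | no  n≢1 with prime-factor n (≤∧≢⇒< (n≢0⇒n>0 n≢0) (≢-sym n≢1))
...   | q , q-prime , q∣n = ⊥-elim (no-factor q q-prime q∣n)

foldr-max : ∀ {x} {xs : List ℕ} → x ∈ xs → x ≤ foldr _⊔_ 0 xs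
foldr-max {x} {y ∷ ys} (here refl) = m≤m⊔n x _
foldr-max {x} {y ∷ ys} (there x∈ys) = m≤n⇒m≤o⊔n y (foldr-max x∈ys)

prime-factor≤P : ∀ {m q} → m ≢ 0 → Prime q → q ∣ m → q ≤ P m
prime-factor≤P {m} {zero}  _   q-prime _ = ⊥-elim (<⇒≱ (prime≥2 q-prime) z≤n)
prime-factor≤P {m} {suc _} m≢0 q-prime q∣m = foldr-max
  (∈-filter⁺ prime? (∈-filter⁺ (_∣? m) (∈-applyUpTo⁺ suc (divisor≤ q∣m m≢0)) q∣m) q-prime)

record LargestPrimeSplit (m : ℕ) : Set where
  field
    n p      : ℕ
    m≡np     : m ≡ n * p
    p-prime  : Prime p
    p∤n      : ¬ p ∣ n
    largest  : ∀ q → Prime q → q ∣ m → q ≤ p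

split-largest-prime : ∀ {m q} → m ≢ 0 → Squarefree m → Prime q → q ∣ m → LargestPrimeSplit m
split-largest-prime {m} {q} m≢0 sqf q-prime q∣m =
  from (largestBelow (λ r → prime? r ×-dec r ∣? m) (suc m) q (q-prime , q∣m) (s≤s (divisor≤ q∣m m≢0)))
  where
  from : Largest (λ r → Prime r × r ∣ m) q (suc m) → LargestPrimeSplit m
  from L with Largest.holds L
  ... | p-prime , divides n m≡np = record
    { n = n ; p = p ; m≡np = m≡np ; p-prime = p-prime ; p∤n = p∤n ; largest = largest }
    where
    p = Largest.value L
    p∤n : ¬ p ∣ n
    p∤n p∣n = sqf p p-prime (subst (p * p ∣_) (sym m≡np) (*-monoˡ-∣ p p∣n))
    largest : ∀ r → Prime r → r ∣ m → r ≤ p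
    largest r r-prime r∣m =
      ≮⇒≥ (λ p<r → Largest.maximal L r p<r (s≤s (divisor≤ r∣m m≢0)) (r-prime , r∣m))

Bridge : ℕ → ℕ → Set
Bridge m x = Σ ℕ λ z → z ∣ m × x < z × z < 2 * x

BridgeUpTo : ℕ → ℕ → ℕ → Set
BridgeUpTo m x B = Σ ℕ λ z → z ∣ m × x < z × z < 2 * x × z ≤ B

Dense : ℕ → Set
Dense m = ∀ x → x ∣ m → 2 ≤ x → 2 * x < m → Bridge m x

-- m is dense below L when each divisor x ≥ 2 that has a larger proper divisor B ≤ L
-- has a bridge not exceeding B; this is the divisor form of the theorem's hypothesis.
DenseBelow : ℕ → ℕ → Set
DenseBelow m L = ∀ x B → x ∣ m → B ∣ m → 2 ≤ x → x < B → B ≤ L → B < m → BridgeUpTo m x B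

bridges-below : ∀ {m L B} → DenseBelow m L → B ∣ m → B ≤ L → B < m →
                ∀ x → x ∣ m → 2 ≤ x → x < B → Bridge m x
bridges-below {B = B} below B∣m B≤L B<m x x∣m 2≤x x<B with below x B x∣m B∣m 2≤x x<B B≤L B<m
... | z , z∣m , x<z , z<2x , _ = z , z∣m , x<z , z<2x

module PrimeCofactor {n p : ℕ} (p-prime : Prime p) (p∤n : ¬ p ∣ n) (n≢0 : n ≢ 0) where

  instance
    p-nonZero : NonZero p
    p-nonZero = prime⇒nonZero p-prime
    n-nonZero : NonZero n
    n-nonZero = ≢-nonZero n≢0

  np≢0 : n * p ≢ 0
  np≢0 np≡0 = n≢0 (m*n≡0⇒m≡0 n p np≡0)

  lift : ∀ {z} → z ∣ n → z ∣ n * p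
  lift z∣n = ∣-trans z∣n (m∣m*n p)

  drop-p : ∀ {z} → z ∣ n * p → z < p → z ∣ n
  drop-p z∣np z<p = cancel-prime p-prime (small-not-multiple (divisor≢0 z∣np np≢0) z<p) z∣np

  -- Density below L ≥ p passes from n·p to n, below p: bridges not exceeding B < p divide n.
  restrict-below : ∀ {L} → p ≤ L → DenseBelow (n * p) L → DenseBelow n p
  restrict-below p≤L below x B x∣n B∣n 2≤x x<B B≤p B<n =
    shrink (below x B (lift x∣n) (lift B∣n) 2≤x x<B (≤-trans B≤p p≤L) (<-≤-trans B<n (m≤m*n n p)))
    where
    B<p : B < p
    B<p = ≤∧≢⇒< B≤p (λ B≡p → p∤n (subst (_∣ n) B≡p B∣n))
    shrink : BridgeUpTo (n * p) x B → BridgeUpTo n x B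
    shrink (z , z∣np , x<z , z<2x , z≤B) = z , drop-p z∣np (≤-<-trans z≤B B<p) , x<z , z<2x , z≤B

  cofactor-times-p : ∀ {u} (u∣n : u ∣ n) → quotient u∣n * p ∣ n * p
  cofactor-times-p u∣n = *-monoˡ-∣ p (quotient-∣ u∣n)

module DenseStep {n p : ℕ} (p-prime : Prime p) (p∤n : ¬ p ∣ n) (n≢0 : n ≢ 0) (2∣n : 2 ∣ n)
                 (dense-n : Dense n)
                 (bridges-below-p : ∀ x → x ∣ n * p → 2 ≤ x → x < p → Bridge (n * p) x) where

  open PrimeCofactor p-prime p∤n n≢0

  -- p is odd: 2 ∣ n but p ∤ n.
  p>2 : 2 < p
  p>2 = ≤∧≢⇒< (prime≥2 p-prime) (λ 2≡p → p∤n (subst (_∣ n) 2≡p 2∣n))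

  -- The largest divisor a of n·p below p (it exists: 2 ∣ n·p and 2 < p).
  open Largest (largestBelow (_∣? n * p) p 2 (lift 2∣n) p>2)
    renaming (value to a; holds to a∣np; atLeast to a≥2; below to a<p; maximal to a-maximal)

  a∣n : a ∣ n
  a∣n = drop-p a∣np a<p

  above-a : ∀ {z} → z ∣ n * p → a < z → p ≤ z
  above-a z∣np a<z = ≮⇒≥ (λ z<p → a-maximal _ a<z z<p z∣np)

  -- The bridge of a lies at or above p, so p < 2a.
  p<2a : p < 2 * a
  p<2a with bridges-below-p a a∣np a≥2 a<p
  ... | z , z∣np , a<z , z<2a = ≤-<-trans (above-a z∣np a<z) z<2a

  -- If p < n then n has a divisor in (p, 2p): a bridge of a in n, or n = 2a itself.
  divisor-after-p : p < n → Σ ℕ λ b → b ∣ n × p < b × b < 2 * p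
  divisor-after-p p<n with 2 * a <? n
  ... | yes 2a<n with dense-n a a∣n a≥2 2a<n
  ...   | z , z∣n , a<z , z<2a =
    z , z∣n , ≤∧≢⇒< (above-a (lift z∣n) a<z) (λ p≡z → p∤n (subst (_∣ n) (sym p≡z) z∣n)) ,
    <-≤-trans z<2a (*-monoʳ-≤ 2 (<⇒≤ a<p))
  divisor-after-p p<n | no 2a≮n = n , ∣-refl , p<n , subst (_< 2 * p) 2a≡n (*-monoʳ-< 2 a<p)
    where
    2a≡n : 2 * a ≡ n
    2a≡n = ≤-antisym (proper-divisor-half a∣n (<-trans a<p p<n)) (≮⇒≥ 2a≮n)

  -- n < p is impossible for n > 2: with n = 2h and h < p, a bridge of h would be a
  -- divisor of n strictly between n/2 and n.
  n≮p : 2 < n → ¬ n < p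
  n≮p 2<n n<p = no-bridge (bridges-below-p h (lift (quotient-∣ 2∣n)) 2≤h (<-trans (quotient-< 2∣n) n<p))
    where
    h = quotient 2∣n
    n≡2h : n ≡ 2 * h
    n≡2h = m∣n⇒n≡m*quotient 2∣n
    2≤h : 2 ≤ h
    2≤h = *-cancelˡ-< 2 1 h (subst (2 <_) n≡2h 2<n)
    no-bridge : Bridge (n * p) h → ⊥
    no-bridge (z , z∣np , h<z , z<2h) = no-divisor-above-half (subst (z ∣_) n≡2h z∣n) h<z z<2h
      where
      z∣n : z ∣ n
      z∣n = drop-p z∣np (<-trans (subst (z <_) (sym n≡2h) z<2h) n<p)

  bridge-at-p : 2 * p < n * p → Bridge (n * p) p
  bridge-at-p 2p<np with <-cmp p n
  ... | tri< p<n _ _ with divisor-after-p p<n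
  ...   | b , b∣n , p<b , b<2p = b , lift b∣n , p<b , b<2p
  bridge-at-p 2p<np | tri≈ _ p≡n _ = ⊥-elim (p∤n (subst (p ∣_) p≡n ∣-refl))
  bridge-at-p 2p<np | tri> _ _ n<p = ⊥-elim (n≮p (*-cancelʳ-< p 2 n 2p<np) n<p)

  -- Multiples y·p: a bridge z of y in n gives the bridge z·p; y = 1 is bridge-at-p.
  bridge-multiple : ∀ y → y ∣ n → 2 ≤ y * p → 2 * (y * p) < n * p → Bridge (n * p) (y * p)
  bridge-multiple zero _ () _
  bridge-multiple 1 _ _ 2p<np =
    subst (Bridge (n * p)) (sym (*-identityˡ p)) (bridge-at-p (subst (λ t → 2 * t < n * p) (*-identityˡ p) 2p<np))
  bridge-multiple y@(suc (suc _)) y∣n _ 2yp<np with dense-n y y∣n (s≤s (s≤s z≤n)) 2y<n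
    where
    2y<n : 2 * y < n
    2y<n = *-cancelʳ-< p (2 * y) n (subst (_< n * p) (sym (*-assoc 2 y p)) 2yp<np)
  ... | z , z∣n , y<z , z<2y =
    z * p , *-monoˡ-∣ p z∣n , *-monoˡ-< p y<z , subst (z * p <_) (*-assoc 2 y p) (*-monoˡ-< p z<2y)

  -- n itself has the bridge (n / a)·p, obtained by scaling a < p < 2a.
  bridge-at-n : Bridge (n * p) n
  bridge-at-n = k * p , cofactor-times-p a∣n ,
                subst (λ t → t < k * p × k * p < 2 * t) (sym (m∣n⇒n≡quotient*m a∣n)) (scale-between k a<p p<2a)
    where
    k = quotient a∣n
    instance
      k-nonZero : NonZero k
      k-nonZero = quotient≢0 a∣n

  -- A divisor x of n with 2x = n and p ∤ x has a bridge: below p by hypothesis, above p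
  -- by scaling a divisor b ∈ (p, 2p) of n with the cofactor n / b.
  bridge-at-half : ∀ {x} → x ∣ n → 2 * x ≡ n → ¬ p ∣ x → 2 ≤ x → Bridge (n * p) x
  bridge-at-half {x} x∣n 2x≡n p∤x 2≤x with <-cmp x p
  ... | tri< x<p _ _ = bridges-below-p x (lift x∣n) 2≤x x<p
  ... | tri≈ _ x≡p _ = ⊥-elim (p∤x (subst (p ∣_) (sym x≡p) ∣-refl))
  ... | tri> _ _ p<x with divisor-after-p (<-trans p<x (subst (x <_) 2x≡n (half<whole (≤-trans (s≤s z≤n) 2≤x))))
  ...   | b , b∣n , p<b , b<2p = k * p , cofactor-times-p b∣n , around-x (scale-between k p<b b<2p)
    where
    k = quotient b∣n
    instance
      k-nonZero : NonZero k
      k-nonZero = quotient≢0 b∣n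
    2x≡kb : 2 * x ≡ k * b
    2x≡kb = trans 2x≡n (m∣n⇒n≡quotient*m b∣n)
    -- kp < kb = 2x < 2kp.
    around-x : k * p < k * b × k * b < 2 * (k * p) → x < k * p × k * p < 2 * x
    around-x (kp<kb , kb<2kp) = *-cancelˡ-< 2 x (k * p) (subst (_< 2 * (k * p)) (sym 2x≡kb) kb<2kp) ,
                                subst (k * p <_) (sym 2x≡kb) kp<kb

  -- Divisors x ≥ 2 of n coprime to p have bridges: in n when 2x < n, otherwise x is n/2 or n.
  bridge-coprime : ∀ {x} → x ∣ n → ¬ p ∣ x → 2 ≤ x → Bridge (n * p) x
  bridge-coprime {x} x∣n p∤x 2≤x with 2 * x <? n | x <? n
  ... | yes 2x<n | _ with dense-n x x∣n 2≤x 2x<n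
  ...   | z , z∣n , x<z , z<2x = z , lift z∣n , x<z , z<2x
  bridge-coprime {x} x∣n p∤x 2≤x | no 2x≮n | yes x<n =
    bridge-at-half x∣n (≤-antisym (proper-divisor-half x∣n x<n) (≮⇒≥ 2x≮n)) p∤x 2≤x
  bridge-coprime {x} x∣n p∤x 2≤x | no _ | no x≮n =
    subst (Bridge (n * p)) (≤-antisym (≮⇒≥ x≮n) (divisor≤ x∣n n≢0)) bridge-at-n

  -- Each divisor of n·p is either a multiple y·p with y ∣ n, or a divisor of n coprime to p.
  dense : Dense (n * p)
  dense x x∣np 2≤x 2x<np with p ∣? x
  ... | yes (divides y refl) = bridge-multiple y (*-cancelʳ-∣ p x∣np) 2≤x 2x<np
  ... | no p∤x = bridge-coprime (cancel-prime p-prime p∤x x∣np) p∤x 2≤x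

-- The only even squarefree number whose largest prime is 2 is 2, and 2 is trivially dense.
dense-two : Dense 2
dense-two x _ 2≤x 2x<2 = ⊥-elim (<⇒≱ 2x<2 (≤-trans (s≤s (s≤s z≤n)) (*-monoʳ-≤ 2 2≤x)))

DensityTransfer : ℕ → Set
DensityTransfer m = ∀ L → Squarefree m → 2 ∣ m → (∀ q → Prime q → q ∣ m → q ≤ L) →
                    DenseBelow m L → Dense m

module Peel {m : ℕ} (m≢0 : m ≢ 0) (split : LargestPrimeSplit m) where
  open LargestPrimeSplit split

  n≢0 : n ≢ 0
  n≢0 refl = m≢0 m≡np

  n∣m : n ∣ m
  n∣m = divides p (trans m≡np (*-comm n p))

  n<m : n < m
  n<m = subst (n <_) (sym m≡np) (m<m*n n p {{≢-nonZero n≢0}} (prime≥2 p-prime))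

  -- If p = 2, every prime factor of n would be p, so n = 1 and m = 2.
  m≡2 : 2 ∣ p → m ≡ 2
  m≡2 2∣p = trans m≡np (cong₂ _*_ n≡1 p≡2)
    where
    p≡2 : p ≡ 2
    p≡2 with prime⇒irreducible p-prime 2∣p
    ... | inj₂ 2≡p = sym 2≡p
    n≡1 : n ≡ 1
    n≡1 = without-prime-factors n≢0 λ q q-prime q∣n →
      p∤n (subst (_∣ n) (≤-antisym (largest q q-prime (∣-trans q∣n n∣m))
                                    (subst (_≤ q) (sym p≡2) (prime≥2 q-prime))) q∣n)

  dense-even : ∀ {L} → 2 ∣ n → DensityTransfer n → Squarefree m →
               (∀ q → Prime q → q ∣ m → q ≤ L) → DenseBelow m L → Dense m
  dense-even {L} 2∣n transfer-n sqf primes≤L below =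
    subst Dense (sym m≡np) (DenseStep.dense p-prime p∤n n≢0 2∣n dense-n bridges)
    where
    p≤L : p ≤ L
    p≤L = primes≤L p p-prime (divides n m≡np)
    below-np : DenseBelow (n * p) L
    below-np = subst (λ t → DenseBelow t L) m≡np below
    dense-n : Dense n
    dense-n = transfer-n p (λ q q-prime q²∣n → sqf q q-prime (∣-trans q²∣n n∣m)) 2∣n
                (λ q q-prime q∣n → largest q q-prime (∣-trans q∣n n∣m))
                (PrimeCofactor.restrict-below p-prime p∤n n≢0 p≤L below-np)
    p<np : p < n * p
    p<np = subst (p <_) (*-comm p n)
             (m<m*n p n {{prime⇒nonZero p-prime}} (divisor≤ 2∣n n≢0))
    bridges : ∀ x → x ∣ n * p → 2 ≤ x → x < p → Bridge (n * p) x
    bridges = bridges-below below-np (n∣m*n n) p≤L p<np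

-- By strong induction, peeling off the largest prime p of m = n·p; n is even unless p = 2.
dense-from-below : ∀ m → DensityTransfer m
dense-from-below = <-rec DensityTransfer transfer
  where
  transfer : ∀ m → (∀ {n} → n < m → DensityTransfer n) → DensityTransfer m
  transfer m rec L sqf 2∣m primes≤L below = peel (split-largest-prime m≢0 sqf prime[2] 2∣m)
    where
    m≢0 : m ≢ 0
    m≢0 refl = sqf 2 prime[2] (_ ∣0)
    peel : LargestPrimeSplit m → Dense m
    peel split with euclidsLemma n p prime[2] (subst (2 ∣_) m≡np 2∣m)
      where open LargestPrimeSplit split
    ... | inj₁ 2∣n = Peel.dense-even m≢0 split 2∣n (rec (Peel.n<m m≢0 split)) sqf primes≤L below
    ... | inj₂ 2∣p = subst Dense (sym (Peel.m≡2 m≢0 split 2∣p)) dense-two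

divisorsUpTo : ℕ → ℕ → List ℕ
divisorsUpTo m k = filter (_∣? m) (applyUpTo suc k)

rank : ℕ → ℕ → ℕ
rank m x = length (divisorsUpTo m x)

divisorsUpTo-suc : ∀ m k → divisorsUpTo m (suc k) ≡ divisorsUpTo m k ++ filter (_∣? m) (suc k ∷ [])
divisorsUpTo-suc m k = begin
  filter (_∣? m) (applyUpTo suc (suc k))               ≡⟨ cong (filter (_∣? m)) (sym (applyUpTo-∷ʳ suc k)) ⟩
  filter (_∣? m) (applyUpTo suc k ++ suc k ∷ [])       ≡⟨ filter-++ (_∣? m) (applyUpTo suc k) (suc k ∷ []) ⟩
  divisorsUpTo m k ++ filter (_∣? m) (suc k ∷ [])      ∎
  where open ≡-Reasoning

divisorsUpTo-new : ∀ {m k} → suc k ∣ m → divisorsUpTo m (suc k) ≡ divisorsUpTo m k ++ suc k ∷ []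
divisorsUpTo-new {m} {k} k+1∣m = trans (divisorsUpTo-suc m k) (cong (divisorsUpTo m k ++_) (filter-accept (_∣? m) k+1∣m))

divisorsUpTo-old : ∀ {m k} → ¬ suc k ∣ m → divisorsUpTo m (suc k) ≡ divisorsUpTo m k
divisorsUpTo-old {m} {k} k+1∤m = begin
  divisorsUpTo m (suc k)                          ≡⟨ divisorsUpTo-suc m k ⟩
  divisorsUpTo m k ++ filter (_∣? m) (suc k ∷ []) ≡⟨ cong (divisorsUpTo m k ++_) (filter-reject (_∣? m) k+1∤m) ⟩
  divisorsUpTo m k ++ []                          ≡⟨ ++-identityʳ _ ⟩
  divisorsUpTo m k                                ∎
  where open ≡-Reasoning

rank-new : ∀ {m k} → suc k ∣ m → rank m (suc k) ≡ suc (rank m k)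
rank-new {m} {k} k+1∣m = trans (cong length (divisorsUpTo-new k+1∣m)) (trans (length-++ (divisorsUpTo m k)) (+-comm (rank m k) 1))

divisorsUpTo-prefix : ∀ m {k k′} → k ≤ k′ → Σ (List ℕ) λ R → divisorsUpTo m k′ ≡ divisorsUpTo m k ++ R
divisorsUpTo-prefix m {k} {zero} z≤n = [] , sym (++-identityʳ _)
divisorsUpTo-prefix m {k} {suc k′} k≤k′+1 with m≤n⇒m<n∨m≡n k≤k′+1
... | inj₂ refl = [] , sym (++-identityʳ _)
... | inj₁ k<k′+1 with divisorsUpTo-prefix m (≤-pred k<k′+1) | suc k′ ∣? m
...   | R , eq | yes k′+1∣m = R ++ suc k′ ∷ [] , (begin
  divisorsUpTo m (suc k′)                      ≡⟨ divisorsUpTo-new k′+1∣m ⟩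
  divisorsUpTo m k′ ++ suc k′ ∷ []             ≡⟨ cong (_++ suc k′ ∷ []) eq ⟩
  (divisorsUpTo m k ++ R) ++ suc k′ ∷ []       ≡⟨ ++-assoc (divisorsUpTo m k) R _ ⟩
  divisorsUpTo m k ++ R ++ suc k′ ∷ []         ∎)
  where open ≡-Reasoning
...   | R , eq | no k′+1∤m = R , trans (divisorsUpTo-old k′+1∤m) eq

rank-mono : ∀ m {k k′} → k ≤ k′ → rank m k ≤ rank m k′
rank-mono m {k} k≤k′ with divisorsUpTo-prefix m k≤k′
... | R , eq = subst (rank m k ≤_) (sym (trans (cong length eq) (length-++ (divisorsUpTo m k)))) (m≤m+n _ _)

rank-strict : ∀ m {x y} → x < y → y ∣ m → rank m x < rank m y
rank-strict m {x} {suc y} (s≤s x≤y) y+1∣m = subst (rank m x <_) (sym (rank-new y+1∣m)) (s≤s (rank-mono m x≤y))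

at-middle : ∀ xs a ys → at (xs ++ a ∷ ys) (suc (length xs)) ≡ a
at-middle []       a ys = refl
at-middle (_ ∷ xs) a ys = at-middle xs a ys

rank-position : ∀ m {x} → x ∣ m → 1 ≤ x → x ≤ m → d m (rank m x) ≡ x
rank-position m {suc x} x+1∣m _ x+1≤m with divisorsUpTo-prefix m x+1≤m
... | R , split = begin
  at (divisors m) (rank m (suc x))                           ≡⟨ cong (at (divisors m)) (rank-new x+1∣m) ⟩
  at (divisors m) (suc (rank m x))                           ≡⟨ cong (λ L → at L (suc (rank m x))) split ⟩
  at (divisorsUpTo m (suc x) ++ R) (suc (rank m x))          ≡⟨ cong (λ L → at (L ++ R) (suc (rank m x))) (divisorsUpTo-new x+1∣m) ⟩
  at ((divisorsUpTo m x ++ suc x ∷ []) ++ R) (suc (rank m x)) ≡⟨ cong (λ L → at L (suc (rank m x))) (++-assoc (divisorsUpTo m x) _ R) ⟩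
  at (divisorsUpTo m x ++ suc x ∷ R) (suc (rank m x))        ≡⟨ at-middle (divisorsUpTo m x) (suc x) R ⟩
  suc x                                                      ∎
  where open ≡-Reasoning

rank-surjective : ∀ m k i → 1 ≤ i → i ≤ rank m k → Σ ℕ λ x → x ∣ m × 1 ≤ x × x ≤ k × rank m x ≡ i
rank-surjective m zero    (suc _) _   ()
rank-surjective m (suc k) i 1≤i i≤rank with i ≤? rank m k | suc k ∣? m
... | yes i≤rank′ | _ with rank-surjective m k i 1≤i i≤rank′
...   | x , x∣m , 1≤x , x≤k , rank≡i = x , x∣m , 1≤x , m≤n⇒m≤1+n x≤k , rank≡i
rank-surjective m (suc k) i 1≤i i≤rank | no i≰rank′ | yes k+1∣m =
  suc k , k+1∣m , s≤s z≤n , ≤-refl , ≤-antisym (subst (_≤ i) (sym (rank-new k+1∣m)) (≰⇒> i≰rank′)) i≤rank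
rank-surjective m (suc k) i 1≤i i≤rank | no i≰rank′ | no k+1∤m =
  ⊥-elim (i≰rank′ (subst (i ≤_) (cong length (divisorsUpTo-old k+1∤m)) i≤rank))

next-above : ∀ m {x s i} → rank m x ≡ i → rank m s ≡ suc i → x < s
next-above m {x} {s} rank-x rank-s = ≰⇒> (λ s≤x → 1+n≰n (subst₂ _≤_ rank-s rank-x (rank-mono m s≤x)))

next-least : ∀ m {x s y i} → rank m x ≡ i → rank m s ≡ suc i → s ∣ m → y ∣ m → x < y → s ≤ y
next-least m {x} {s} {y} rank-x rank-s s∣m y∣m x<y = ≮⇒≥ λ y<s → 1+n≰n (≤-trans
  (subst (λ t → suc t ≤ rank m y) rank-x (rank-strict m x<y y∣m))
  (≤-pred (subst (rank m y <_) rank-s (rank-strict m y<s s∣m))))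

suc<⇒<∸1 : ∀ {a t} → suc a < t → a < t ∸ 1
suc<⇒<∸1 {t = suc t} (s≤s a<t) = a<t

<∸1⇒suc< : ∀ {a t} → a < t ∸ 1 → suc a < t
<∸1⇒suc< {t = zero}  ()
<∸1⇒suc< {t = suc t} a<t = s≤s a<t

suc-∸1 : ∀ {t} → 1 ≤ t → suc (t ∸ 1) ≡ t
suc-∸1 {suc t} _ = refl

module Positions (m : ℕ) (m>1 : 1 < m) where

  m≢0 : m ≢ 0
  m≢0 m≡0 = <⇒≱ m>1 (subst (_≤ 1) (sym m≡0) z≤n)

  instance
    m-nonZero : NonZero m
    m-nonZero = ≢-nonZero m≢0

  rank-at : ∀ {x} → x ∣ m → d m (rank m x) ≡ x
  rank-at x∣m = rank-position m x∣m (n≢0⇒n>0 (divisor≢0 x∣m m≢0)) (divisor≤ x∣m m≢0)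

  rank-one : rank m 1 ≡ 1
  rank-one = rank-new (1∣ m)

  d-one : d m 1 ≡ 1
  d-one = subst (λ i → d m i ≡ 1) rank-one (rank-at (1∣ m))

  τ≥2 : 2 ≤ τ m
  τ≥2 = subst (_< τ m) rank-one (rank-strict m m>1 ∣-refl)

  Position : ℕ → Set
  Position i = Σ ℕ λ x → x ∣ m × rank m x ≡ i × d m i ≡ x

  position : ∀ {i} → 1 ≤ i → i ≤ τ m → Position i
  position {i} 1≤i i≤τ with rank-surjective m m i 1≤i i≤τ
  ... | x , x∣m , _ , _ , rank≡i = x , x∣m , rank≡i , subst (λ j → d m j ≡ x) rank≡i (rank-at x∣m)

  two-divides : d m 2 ≡ 2 * d m 1 → 2 ∣ m
  two-divides d₂≡2d₁ = from-second (position (s≤s z≤n) τ≥2)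
    where
    from-second : Position 2 → 2 ∣ m
    from-second (x , x∣m , _ , d₂≡x) = subst (_∣ m) (trans (sym d₂≡x) (trans d₂≡2d₁ (cong (2 *_) d-one))) x∣m

  -- The hypothesis on consecutive divisors up to P(m) gives density below P(m): the
  -- divisor following x is at most B and is the required bridge.
  below-from-gaps : (∀ i → 1 < i → i < τ m ∸ 1 → d m (suc i) ≤ P m → d m (suc i) < 2 * d m i) →
                    DenseBelow m (P m)
  below-from-gaps gaps x B x∣m B∣m 2≤x x<B B≤P B<m =
    from-next (position (s≤s z≤n) (≤-trans (rank-strict m x<B B∣m) (rank-mono m (divisor≤ B∣m m≢0))))
    where
    from-next : Position (suc (rank m x)) → Σ ℕ λ z → z ∣ m × x < z × z < 2 * x × z ≤ B
    from-next (s , s∣m , rank-s , dᵢ₊₁≡s) = s , s∣m , next-above m refl rank-s , s<2x , s≤B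
      where
      s≤B : s ≤ B
      s≤B = next-least m refl rank-s s∣m B∣m x<B
      1<i : 1 < rank m x
      1<i = subst (_< rank m x) rank-one (rank-strict m 2≤x x∣m)
      i<τ-1 : rank m x < τ m ∸ 1
      i<τ-1 = suc<⇒<∸1 (subst (_< τ m) rank-s (rank-strict m (≤-<-trans s≤B B<m) ∣-refl))
      s<2x : s < 2 * x
      s<2x = subst₂ (λ u v → u < 2 * v) dᵢ₊₁≡s (rank-at x∣m)
               (gaps (rank m x) 1<i i<τ-1 (subst (_≤ P m) (sym dᵢ₊₁≡s) (≤-trans s≤B B≤P)))

  -- Density gives the middle ratios: dᵢ₊₁ is at most the bridge of dᵢ.
  gaps-from-dense : Dense m → ∀ i → 1 < i → i < τ m ∸ 1 → d m (suc i) < 2 * d m i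
  gaps-from-dense dense i 1<i i<τ-1 = from-neighbours (position (<⇒≤ 1<i) (<⇒≤ (<-trans (n<1+n i) i+1<τ)))
                                               (position (s≤s z≤n) (<⇒≤ i+1<τ))
    where
    i+1<τ : suc i < τ m
    i+1<τ = <∸1⇒suc< i<τ-1
    from-neighbours : Position i → Position (suc i) → d m (suc i) < 2 * d m i
    from-neighbours (x , x∣m , rank-x , dᵢ≡x) (s , s∣m , rank-s , dᵢ₊₁≡s) = conclude (dense x x∣m 2≤x 2x<m)
      where
      2≤x : 2 ≤ x
      2≤x = ≤∧≢⇒< (n≢0⇒n>0 (divisor≢0 x∣m m≢0))
              (λ 1≡x → <⇒≢ 1<i (trans (sym rank-one) (trans (cong (rank m) 1≡x) rank-x)))
      s<m : s < m
      s<m = ≤∧≢⇒< (divisor≤ s∣m m≢0) (λ s≡m → <⇒≢ i+1<τ (trans (sym rank-s) (cong (rank m) s≡m)))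
      2x<m : 2 * x < m
      2x<m = <-≤-trans (*-monoʳ-< 2 (next-above m {x} {s} rank-x rank-s)) (proper-divisor-half s∣m s<m)
      conclude : Bridge m x → d m (suc i) < 2 * d m i
      conclude (z , z∣m , x<z , z<2x) = subst₂ (λ u v → u < 2 * v) (sym dᵢ₊₁≡s) (sym dᵢ≡x)
        (≤-<-trans (next-least m rank-x rank-s s∣m z∣m x<z) z<2x)

  -- For even m the second largest divisor is m / 2.
  last-ratio : 2 ∣ m → d m (τ m) ≡ 2 * d m (τ m ∸ 1)
  last-ratio 2∣m = from-last (position (suc<⇒<∸1 τ≥2) (m∸n≤m (τ m) 1))
    where
    h = quotient 2∣m
    m≡2h : m ≡ 2 * h
    m≡2h = m∣n⇒n≡m*quotient 2∣m
    from-last : Position (τ m ∸ 1) → d m (τ m) ≡ 2 * d m (τ m ∸ 1)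
    from-last (y , y∣m , rank-y , d≡y) = begin
      d m (τ m)             ≡⟨ rank-at ∣-refl ⟩
      m                     ≡⟨ m≡2h ⟩
      2 * h                 ≡⟨ cong (2 *_) (sym y≡h) ⟩
      2 * y                 ≡⟨ cong (2 *_) (sym d≡y) ⟩
      2 * d m (τ m ∸ 1)     ∎
      where
      open ≡-Reasoning
      rank-m : rank m m ≡ suc (τ m ∸ 1)
      rank-m = sym (suc-∸1 (<⇒≤ τ≥2))
      y≤h : y ≤ h
      y≤h = *-cancelˡ-≤ 2 (subst (2 * y ≤_) m≡2h (proper-divisor-half y∣m (next-above m rank-y rank-m)))
      h≤y : h ≤ y
      h≤y = ≮⇒≥ λ y<h → <⇒≱ (quotient-< 2∣m) (next-least m rank-y rank-m ∣-refl (quotient-∣ 2∣m) y<h)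
      y≡h : y ≡ h
      y≡h = ≤-antisym y≤h h≤y

lemma5p7 : (m : ℕ) → 1 < m → Squarefree m
    → d m 2 ≡ 2 * d m 1
    → (∀ i → 1 < i → i < τ m ∸ 1 → d m (suc i) ≤ P m → d m (suc i) < 2 * d m i)
    → StrictlyTwoDense m
lemma5p7 m m>1 sqf d₂≡2d₁ gaps = sqf , gaps-from-dense dense-m , d₂≡2d₁ , last-ratio 2∣m
  where
  open Positions m m>1
  2∣m : 2 ∣ m
  2∣m = two-divides d₂≡2d₁
  dense-m : Dense m
  dense-m = dense-from-below m (P m) sqf 2∣m (λ q q-prime q∣m → prime-factor≤P m≢0 q-prime q∣m)
              (below-from-gaps gaps)
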